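{- Let $U\in\mathbb U^+$. Then: (1) if $M\in[U]$, then $M\rhd_\beta^* N$ for some closed term $N$; (2) $[U]=\{M\in\mathcal M\mid M\rhd_\beta^* N\text{ for some }N\text{ with }N:\langle ()\vdash U\rangle\}$.
   Context: Terms: $\mathcal V$ is a denumerably infinite set of variables; $\mathcal M$ is the set of untyped $\lambda$-terms $M::=x\mid \lambda x.M\mid MM$ taken modulo $\alpha$-conversion; $FV(M)$ is the set of free variables; a term is closed if $FV(M)=\emptyset$. $\rhd_\beta$ is the compatible closure of $(\lambda x.M)N\rhd_\beta M[x:=N]$ and $\rhd_\beta^*$ its reflexive-transitive closure. Types: $\mathcal A$ is a denumerably infinite set of atomic types; $\mathbb T::=a\mid \mathbb U\to\mathbb T$ ($a\in\mathcal A$) and $\mathbb U::=\omega\mid \mathbb U\sqcap\mathbb U\mid \mathbb T$; types are quotiented by commutativity, associativity and idempotence of $\sqcap$ and by $\omega\sqcap U=U$. $T$ ranges over $\mathbb T$, $U,V$ over $\mathbb U$. The subsets $\mathbb U^+,\mathbb U^-\subseteq\mathbb U$ are defined simultaneously: every $a\in\mathcal A$ is in both; $\omega\in\mathbb U^-$; if $U\in\mathbb U^+$ then $U\sqcap V\in\mathbb U^+$ (any $V$); if $U,V\in\mathbb U^-$ then $U\sqcap V\in\mathbb U^-$; if $U\in\mathbb U^-$ and $T\in\mathbb U^+$ then $U\to T\in\mathbb U^+$; if $U\in\mathbb U^+$ and $T\in\mathbb U^-$ then $U\to T\in\mathbb U^-$. Environments: a type environment is a finite set $(x_i:U_i)_n$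 of declarations with pairwise distinct variables; $dom$ is its set of variables; $()$ is the empty environment; $\Gamma,x:U$ requires $x\notin dom(\Gamma)$; $env^M_\omega$ assigns $\omega$ to each variable of $FV(M)$ and nothing else; if $\Gamma_1=(x_i:U_i)_n,(y_j:V_j)_m$ and $\Gamma_2=(x_i:U'_i)_n,(z_k:W_k)_l$ with the $y_j$, $z_k$ all distinct, then $\Gamma_1\sqcap\Gamma_2=(x_i:U_i\sqcap U'_i)_n,(y_j:V_j)_m,(z_k:W_k)_l$. Subtyping: $\sqsubseteq$ (on types, on environments, and on typings $\langle\Gamma\vdash U\rangle$) is the least relation closed under: $\Phi\sqsubseteq\Phi$; transitivity; $U_1\sqcap U_2\sqsubseteq U_1$; if $U_1\sqsubseteq V_1$ and $U_2\sqsubseteq V_2$ then $U_1\sqcap U_2\sqsubseteq V_1\sqcap V_2$; if $U_2\sqsubseteq U_1$ and $T_1\sqsubseteq T_2$ then $U_1\to T_1\sqsubseteq U_2\to T_2$; if $U_1\sqsubseteq U_2$ and $x\notin dom(\Gamma)$ then $\Gamma,x:U_1\sqsubseteq\Gamma,x:U_2$; if $U_1\sqsubseteq U_2$ and $\Gamma_2\sqsubseteq\Gamma_1$ then $\langle\Gamma_1\vdash U_1\rangle\sqsubseteq\langle\Gamma_2\vdash U_2\rangle$. Typing rules for $M:\langle\Gamma\vdash U\rangle$: (ax) $x:\langle x:T\vdash T\rangle$ for $T\in\mathbb T$; ($\omega$) $M:\langle env^M_\omega\vdash\omega\rangle$; ($\to_i$) from $M:\langle\Gamma,x:U\vdash T\rangle$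 infer $\lambda x.M:\langle\Gamma\vdash U\to T\rangle$; ($\to'_i$) from $M:\langle\Gamma\vdash T\rangle$ and $x\notin dom(\Gamma)$ infer $\lambda x.M:\langle\Gamma\vdash\omega\to T\rangle$; ($\to_e$) from $M_1:\langle\Gamma_1\vdash U\to T\rangle$ and $M_2:\langle\Gamma_2\vdash U\rangle$ infer $M_1M_2:\langle\Gamma_1\sqcap\Gamma_2\vdash T\rangle$; ($\sqcap_i$) from $M:\langle\Gamma\vdash U_1\rangle$ and $M:\langle\Gamma\vdash U_2\rangle$ infer $M:\langle\Gamma\vdash U_1\sqcap U_2\rangle$; ($\sqsubseteq$) from $M:\langle\Gamma\vdash U\rangle$ and $\langle\Gamma\vdash U\rangle\sqsubseteq\langle\Gamma'\vdash U'\rangle$ infer $M:\langle\Gamma'\vdash U'\rangle$. Semantics: for $\mathcal X,\mathcal Y\subseteq\mathcal M$, $\mathcal X\leadsto\mathcal Y=\{M\in\mathcal M\mid MN\in\mathcal Y\text{ for all }N\in\mathcal X\}$. $\mathcal X$ is $\beta$-saturated if $M\rhd_\beta^*N$ and $N\in\mathcal X$ imply $M\in\mathcal X$. A $\beta$-interpretation is a function $\mathcal I:\mathcal A\to\mathcal P(\mathcal M)$ with every $\mathcal I(a)$ $\beta$-saturated, extended to $\mathbb U$ by $\mathcal I(\omega)=\mathcal M$, $\mathcal I(U_1\sqcap U_2)=\mathcal I(U_1)\cap\mathcal I(U_2)$, $\mathcal I(U\to T)=\mathcal I(U)\leadsto\mathcal I(T)$. The meaning of $U$ is $[U]=\bigcap\{\mathcal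 I(U)\mid \mathcal I\text{ a }\beta\text{ -interpretation}\}$. -}

module Defs where

open import Data.Nat using (ℕ; zero; suc; _≡ᵇ_)
open import Data.Bool using (Bool; true; false; _∨_; if_then_else_)
open import Data.Maybe using (Maybe; just; nothing)
open import Data.Maybe.Relation.Binary.Pointwise using (Pointwise)
open import Data.Product using (_×_; Σ; ∃)
open import Data.Unit using (⊤)
open import Relation.Binary.PropositionalEquality using (_≡_)
open import Relation.Binary.Construct.Closure.ReflexiveTransitive using (Star)

-- Untyped λ-terms modulo α-conversion: de Bruijn indices
-- (a canonical representative of each α-class). Variable 'var n' is free
-- variable n when not under binders.

data Term : Set where
  var : ℕ → Term
  lam : Term → Term
  app : Term → Term → Term

fv : ℕ → Term → Bool
fv x (var y)   = x ≡ᵇ y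
fv x (lam M)   = fv (suc x) M
fv x (app M N) = fv x M ∨ fv x N

Closed : Term → Set
Closed M = ∀ x → fv x M ≡ false

ext : (ℕ → ℕ) → ℕ → ℕ
ext ρ zero    = zero
ext ρ (suc n) = suc (ρ n)

rename : (ℕ → ℕ) → Term → Term
rename ρ (var x)   = var (ρ x)
rename ρ (lam M)   = lam (rename (ext ρ) M)
rename ρ (app M N) = app (rename ρ M) (rename ρ N)

exts : (ℕ → Term) → ℕ → Term
exts σ zero    = var zero
exts σ (suc n) = rename suc (σ n)

subst : (ℕ → Term) → Term → Term
subst σ (var x)   = σ x
subst σ (lam M)   = lam (subst (exts σ) M)
subst σ (app M N) = app (subst σ M) (subst σ N)

-- σ for M[0 := N] (lowering the other indices)
single : Term → ℕ → Term
single N zero    = N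
single N (suc n) = var n

_[0≔_] : Term → Term → Term
M [0≔ N ] = subst (single N) M

data _▷β_ : Term → Term → Set where
  β    : ∀ {M N} → app (lam M) N ▷β (M [0≔ N ])
  ξlam : ∀ {M M'} → M ▷β M' → lam M ▷β lam M'
  ξl   : ∀ {M M' N} → M ▷β M' → app M N ▷β app M' N
  ξr   : ∀ {M N N'} → N ▷β N' → app M N ▷β app M N'

_▷β*_ : Term → Term → Set
_▷β*_ = Star _▷β_

-- Syntactic representatives; the quotient by
-- ACI of ⊓ and ω ⊓ U = U is handled by the congruence _≈_ below, which
-- is included in subtyping and in the closure of 𝕌⁺ / 𝕌⁻.

infixr 7 _⇒_
infixl 6 _⊓_

mutual
  data Ty : Set where
    atom : ℕ → Ty
    _⇒_  : UTy → Ty → Ty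

  data UTy : Set where
    ω   : UTy
    _⊓_ : UTy → UTy → UTy
    ↑_  : Ty → UTy

data _≈_ : UTy → UTy → Set where
  ≈refl  : ∀ {U} → U ≈ U
  ≈sym   : ∀ {U V} → U ≈ V → V ≈ U
  ≈trans : ∀ {U V W} → U ≈ V → V ≈ W → U ≈ W
  ≈⊓     : ∀ {U U' V V'} → U ≈ U' → V ≈ V' → (U ⊓ V) ≈ (U' ⊓ V')
  ≈⇒     : ∀ {U U' T T'} → U ≈ U' → (↑ T) ≈ (↑ T') → (↑ (U ⇒ T)) ≈ (↑ (U' ⇒ T'))
  ≈comm  : ∀ {U V} → (U ⊓ V) ≈ (V ⊓ U)
  ≈assoc : ∀ {U V W} → ((U ⊓ V) ⊓ W) ≈ (U ⊓ (V ⊓ W))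
  ≈idem  : ∀ {U} → (U ⊓ U) ≈ U
  ≈unit  : ∀ {U} → (ω ⊓ U) ≈ U

mutual
  data Pos : UTy → Set where
    p-atom : ∀ a → Pos (↑ atom a)
    p-⊓    : ∀ {U} V → Pos U → Pos (U ⊓ V)
    p-⇒    : ∀ {U T} → Neg U → Pos (↑ T) → Pos (↑ (U ⇒ T))
    p-≈    : ∀ {U V} → Pos U → U ≈ V → Pos V

  data Neg : UTy → Set where
    n-atom : ∀ a → Neg (↑ atom a)
    n-ω    : Neg ω
    n-⊓    : ∀ {U V} → Neg U → Neg V → Neg (U ⊓ V)
    n-⇒    : ∀ {U T} → Pos U → Neg (↑ T) → Neg (↑ (U ⇒ T))
    n-≈    : ∀ {U V} → Neg U → U ≈ V → Neg V

data _⊑_ : UTy → UTy → Set where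
  ⊑≈     : ∀ {U V} → U ≈ V → U ⊑ V
  ⊑trans : ∀ {U V W} → U ⊑ V → V ⊑ W → U ⊑ W
  ⊑⊓l    : ∀ {U₁ U₂} → (U₁ ⊓ U₂) ⊑ U₁
  ⊑⊓     : ∀ {U₁ U₂ V₁ V₂} → U₁ ⊑ V₁ → U₂ ⊑ V₂ → (U₁ ⊓ U₂) ⊑ (V₁ ⊓ V₂)
  ⊑⇒     : ∀ {U₁ U₂ T₁ T₂} → U₂ ⊑ U₁ → (↑ T₁) ⊑ (↑ T₂) →
           (↑ (U₁ ⇒ T₁)) ⊑ (↑ (U₂ ⇒ T₂))

-- Environments: partial maps from (de Bruijn) variables to types;
-- 'nothing' means x ∉ dom Γ.

Env : Set
Env = ℕ → Maybe UTy

emptyEnv : Env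
emptyEnv _ = nothing

single-env : ℕ → UTy → Env
single-env x U y = if x ≡ᵇ y then just U else nothing

envω : Term → Env
envω M x = if fv x M then just ω else nothing

meetM : Maybe UTy → Maybe UTy → Maybe UTy
meetM (just U) (just V) = just (U ⊓ V)
meetM (just U) nothing  = just U
meetM nothing  m        = m

_⊓ₑ_ : Env → Env → Env
(Γ₁ ⊓ₑ Γ₂) x = meetM (Γ₁ x) (Γ₂ x)

-- environment subtyping (pointwise, same domain)
_⊑ₑ_ : Env → Env → Set
Γ ⊑ₑ Δ = ∀ x → Pointwise _⊑_ (Γ x) (Δ x)

-- environment of a λ-abstraction from that of its body (drop variable 0)
tailEnv : Env → Env
tailEnv Γ n = Γ (suc n)

data _⦂⟨_⊢_⟩ : Term → Env → UTy → Set where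
  ax   : ∀ x (T : Ty) → var x ⦂⟨ single-env x (↑ T) ⊢ ↑ T ⟩
  ωr   : ∀ M → M ⦂⟨ envω M ⊢ ω ⟩
  →i   : ∀ {Γ M U T} → M ⦂⟨ Γ ⊢ ↑ T ⟩ → Γ zero ≡ just U →
         lam M ⦂⟨ tailEnv Γ ⊢ ↑ (U ⇒ T) ⟩
  →i'  : ∀ {Γ M T} → M ⦂⟨ Γ ⊢ ↑ T ⟩ → Γ zero ≡ nothing →
         lam M ⦂⟨ tailEnv Γ ⊢ ↑ (ω ⇒ T) ⟩
  →e   : ∀ {Γ₁ Γ₂ M₁ M₂ U T} → M₁ ⦂⟨ Γ₁ ⊢ ↑ (U ⇒ T) ⟩ → M₂ ⦂⟨ Γ₂ ⊢ U ⟩ →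
         app M₁ M₂ ⦂⟨ Γ₁ ⊓ₑ Γ₂ ⊢ ↑ T ⟩
  ⊓i   : ∀ {Γ M U₁ U₂} → M ⦂⟨ Γ ⊢ U₁ ⟩ → M ⦂⟨ Γ ⊢ U₂ ⟩ → M ⦂⟨ Γ ⊢ U₁ ⊓ U₂ ⟩
  ⊑r   : ∀ {Γ Γ' M U U'} → M ⦂⟨ Γ ⊢ U ⟩ → U ⊑ U' → Γ' ⊑ₑ Γ → M ⦂⟨ Γ' ⊢ U' ⟩

Pred : Set₁
Pred = Term → Set

_↝_ : Pred → Pred → Pred
(X ↝ Y) M = ∀ N → X N → Y (app M N)

βSaturated : Pred → Set
βSaturated X = ∀ {M N} → M ▷β* N → X N → X M

mutual
  ⟦_⟧T : Ty → (ℕ → Pred) → Pred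
  ⟦ atom a ⟧T I = I a
  ⟦ U ⇒ T ⟧T I = ⟦ U ⟧ I ↝ ⟦ T ⟧T I

  ⟦_⟧ : UTy → (ℕ → Pred) → Pred
  ⟦ ω ⟧     I M = ⊤
  ⟦ U ⊓ V ⟧ I M = ⟦ U ⟧ I M × ⟦ V ⟧ I M
  ⟦ ↑ T ⟧   I M = ⟦ T ⟧T I M

-- [U] : intersection over all β-interpretations
Meaning : UTy → Term → Set₁
Meaning U M = ∀ (I : ℕ → Pred) → (∀ a → βSaturated (I a)) → ⟦ U ⟧ I M

module Submission where

open import Defs
open import Data.Product using (_×_; Σ; ∃)
open import Function.Bundles using (_⇔_)

open import Data.Nat using (ℕ; zero; suc; _≡ᵇ_; _+_; _*_; _≤_; _<_; _⊔_; _%_; pred; z≤n; s≤s)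
import Data.Nat.Properties as NP
import Data.Nat.DivMod as DM
open import Data.Bool using (true; false; if_then_else_)
open import Data.Bool.Properties using (T-≡; ∨-zeroʳ; ∨-conicalˡ; ∨-conicalʳ)
open import Data.Maybe using (Maybe; just; nothing)
open import Data.Maybe.Relation.Binary.Pointwise using (Pointwise; just; nothing)
open import Data.Product using (_,_; proj₁; proj₂)
open import Data.Sum using (_⊎_; inj₁; inj₂; [_,_])
open import Data.Unit using (tt)
open import Data.Empty using (⊥; ⊥-elim)
open import Data.List using (List; []; _∷_; _++_; length)
open import Data.List.Properties using (++-assoc)
open import Data.List.Membership.Propositional using (_∈_)
open import Data.List.Membership.Propositional.Properties using (∈-++⁺ˡ; ∈-++⁺ʳ; ∈-++⁻)
open import Data.List.Relation.Binary.Permutation.Propositional.Properties using (∈-resp-↭; ++-comm)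
open import Data.List.Relation.Unary.Any using (here; there)
open import Function using (id)
open import Function.Bundles using (mk⇔; Equivalence)
open import Relation.Binary.PropositionalEquality
  using (_≡_; _≢_; _≗_; refl; sym; trans; cong; cong₂) renaming (subst to transport)
open import Relation.Binary.Construct.Closure.ReflexiveTransitive using (Star; ε; _◅_; _◅◅_; gmap; kleisliStar)

_∈FV_ : ℕ → Term → Set
x ∈FV M = fv x M ≡ true

≡ᵇ-sound : ∀ m n → (m ≡ᵇ n) ≡ true → m ≡ n
≡ᵇ-sound m n e = NP.≡ᵇ⇒≡ m n (Equivalence.from T-≡ e)

≡ᵇ-refl : ∀ n → (n ≡ᵇ n) ≡ true
≡ᵇ-refl n = Equivalence.to T-≡ (NP.≡⇒≡ᵇ n n refl)

≡ᵇ-false : ∀ m n → m ≢ n → (m ≡ᵇ n) ≡ false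
≡ᵇ-false m n m≢n with m ≡ᵇ n in eq
... | true  = ⊥-elim (m≢n (≡ᵇ-sound m n eq))
... | false = refl

≡ᵇ-sym : ∀ m n → (m ≡ᵇ n) ≡ (n ≡ᵇ m)
≡ᵇ-sym zero    zero    = refl
≡ᵇ-sym zero    (suc n) = refl
≡ᵇ-sym (suc m) zero    = refl
≡ᵇ-sym (suc m) (suc n) = ≡ᵇ-sym m n

∈FV-contra : ∀ {x M} → x ∈FV M → fv x M ≡ false → ⊥
∈FV-contra e f with trans (sym e) f
... | ()

fv-appˡ : ∀ {x} M N → x ∈FV M → x ∈FV app M N
fv-appˡ {x} M N e rewrite e = refl

fv-appʳ : ∀ {x} M N → x ∈FV N → x ∈FV app M N
fv-appʳ {x} M N e rewrite e = ∨-zeroʳ (fv x M)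

fv-app⁻ : ∀ {x} M N → x ∈FV app M N → x ∈FV M ⊎ x ∈FV N
fv-app⁻ {x} M N e with fv x M
... | true  = inj₁ refl
... | false = inj₂ e

closed-by-fv : ∀ {N} → (∀ x → x ∈FV N → ⊥) → Closed N
closed-by-fv {N} h x with fv x N in eq
... | false = refl
... | true  = ⊥-elim (h x eq)

ext-cong : ∀ {ρ ρ'} → ρ ≗ ρ' → ext ρ ≗ ext ρ'
ext-cong e zero    = refl
ext-cong e (suc x) = cong suc (e x)

rename-cong : ∀ {ρ ρ'} → ρ ≗ ρ' → ∀ M → rename ρ M ≡ rename ρ' M
rename-cong e (var x)   = cong var (e x)
rename-cong e (lam M)   = cong lam (rename-cong (ext-cong e) M)
rename-cong e (app M N) = cong₂ app (rename-cong e M) (rename-cong e N)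

exts-cong : ∀ {σ τ} → σ ≗ τ → exts σ ≗ exts τ
exts-cong e zero    = refl
exts-cong e (suc x) = cong (rename suc) (e x)

subst-cong : ∀ {σ τ} → σ ≗ τ → ∀ M → subst σ M ≡ subst τ M
subst-cong e (var x)   = e x
subst-cong e (lam M)   = cong lam (subst-cong (exts-cong e) M)
subst-cong e (app M N) = cong₂ app (subst-cong e M) (subst-cong e N)

rename-rename : ∀ ρ ρ' M → rename ρ (rename ρ' M) ≡ rename (λ x → ρ (ρ' x)) M
rename-rename ρ ρ' (var x)   = refl
rename-rename ρ ρ' (lam M)   = cong lam (trans (rename-rename (ext ρ) (ext ρ') M)
  (rename-cong (λ { zero → refl ; (suc x) → refl }) M))
rename-rename ρ ρ' (app M N) = cong₂ app (rename-rename ρ ρ' M) (rename-rename ρ ρ' N)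

rename-subst : ∀ ρ σ M → rename ρ (subst σ M) ≡ subst (λ x → rename ρ (σ x)) M
rename-subst ρ σ (var x)   = refl
rename-subst ρ σ (lam M)   = cong lam (trans (rename-subst (ext ρ) (exts σ) M)
  (subst-cong (λ { zero → refl ; (suc x) → trans (rename-rename (ext ρ) suc (σ x))
     (sym (rename-rename suc ρ (σ x))) }) M))
rename-subst ρ σ (app M N) = cong₂ app (rename-subst ρ σ M) (rename-subst ρ σ N)

subst-rename : ∀ σ ρ M → subst σ (rename ρ M) ≡ subst (λ x → σ (ρ x)) M
subst-rename σ ρ (var x)   = refl
subst-rename σ ρ (lam M)   = cong lam (trans (subst-rename (exts σ) (ext ρ) M)
  (subst-cong (λ { zero → refl ; (suc x) → refl }) M))
subst-rename σ ρ (app M N) = cong₂ app (subst-rename σ ρ M) (subst-rename σ ρ N)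

subst-subst : ∀ σ τ M → subst σ (subst τ M) ≡ subst (λ x → subst σ (τ x)) M
subst-subst σ τ (var x)   = refl
subst-subst σ τ (lam M)   = cong lam (trans (subst-subst (exts σ) (exts τ) M)
  (subst-cong (λ { zero → refl ; (suc x) → trans (subst-rename (exts σ) suc (τ x))
     (sym (rename-subst suc σ (τ x))) }) M))
subst-subst σ τ (app M N) = cong₂ app (subst-subst σ τ M) (subst-subst σ τ N)

subst-var : ∀ M → subst var M ≡ M
subst-var (var x)   = refl
subst-var (lam M)   = cong lam (trans (subst-cong (λ { zero → refl ; (suc x) → refl }) M) (subst-var M))
subst-var (app M N) = cong₂ app (subst-var M) (subst-var N)

rename-as-subst : ∀ ρ M → rename ρ M ≡ subst (λ x → var (ρ x)) M
rename-as-subst ρ (var x)   = refl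
rename-as-subst ρ (lam M)   = cong lam (trans (rename-as-subst (ext ρ) M)
  (subst-cong (λ { zero → refl ; (suc x) → refl }) M))
rename-as-subst ρ (app M N) = cong₂ app (rename-as-subst ρ M) (rename-as-subst ρ N)

rename-id : ∀ M → rename id M ≡ M
rename-id M = trans (rename-as-subst id M) (subst-var M)

rename-fv-cong : ∀ {ρ ρ'} M → (∀ y → y ∈FV M → ρ y ≡ ρ' y) → rename ρ M ≡ rename ρ' M
rename-fv-cong (var x) h = cong var (h x (≡ᵇ-refl x))
rename-fv-cong {ρ} {ρ'} (lam M) h = cong lam (rename-fv-cong M h')
  where h' : ∀ y → y ∈FV M → ext ρ y ≡ ext ρ' y
        h' zero    _ = refl
        h' (suc y) e = cong suc (h y e)
rename-fv-cong (app M N) h = cong₂ app (rename-fv-cong M (λ y e → h y (fv-appˡ M N e)))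
                                       (rename-fv-cong N (λ y e → h y (fv-appʳ M N e)))

_∷ˢ_ : Term → (ℕ → Term) → ℕ → Term
(N ∷ˢ σ) zero    = N
(N ∷ˢ σ) (suc n) = σ n

subst-exts-single : ∀ σ N M → (subst (exts σ) M) [0≔ N ] ≡ subst (N ∷ˢ σ) M
subst-exts-single σ N M = trans (subst-subst (single N) (exts σ) M)
  (subst-cong (λ { zero → refl ; (suc x) → trans (subst-rename (single N) suc (σ x)) (subst-var (σ x)) }) M)

subst-commute : ∀ σ M N → subst σ (M [0≔ N ]) ≡ (subst (exts σ) M) [0≔ subst σ N ]
subst-commute σ M N = trans (subst-subst σ (single N) M)
  (trans (subst-cong (λ { zero → refl ; (suc x) → refl }) M) (sym (subst-exts-single σ (subst σ N) M)))

rename-commute : ∀ ρ M N → rename ρ (M [0≔ N ]) ≡ (rename (ext ρ) M) [0≔ rename ρ N ]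
rename-commute ρ M N = trans (rename-as-subst ρ (M [0≔ N ]))
  (trans (subst-commute (λ x → var (ρ x)) M N)
  (sym (cong₂ _[0≔_] (trans (rename-as-subst (ext ρ) M) (subst-cong (λ { zero → refl ; (suc x) → refl }) M))
                      (rename-as-subst ρ N))))

bind0 : ℕ → ℕ → ℕ
bind0 x zero    = x
bind0 x (suc n) = n

single-var-as-rename : ∀ x P → (P [0≔ var x ]) ≡ rename (bind0 x) P
single-var-as-rename x P =
  sym (trans (rename-as-subst (bind0 x) P) (subst-cong (λ { zero → refl ; (suc n) → refl }) P))

unbind0 : ℕ → ℕ → ℕ
unbind0 x y = if y ≡ᵇ x then zero else suc y

unbind-bind : ∀ x P → fv x (lam P) ≡ false → rename (unbind0 x) (rename (bind0 x) P) ≡ P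
unbind-bind x P x∉P = trans (rename-rename (unbind0 x) (bind0 x) P)
                            (trans (rename-fv-cong P inverse) (rename-id P))
  where inverse : ∀ y → y ∈FV P → unbind0 x (bind0 x y) ≡ y
        inverse zero    _ rewrite ≡ᵇ-refl x = refl
        inverse (suc n) e rewrite ≡ᵇ-false n x (λ { refl → ∈FV-contra {suc n} {P} e x∉P }) = refl

fv-rename⁻ : ∀ ρ M x → x ∈FV rename ρ M → ∃ λ y → y ∈FV M × ρ y ≡ x
fv-rename⁻ ρ (var y) x e = y , ≡ᵇ-refl y , sym (≡ᵇ-sound x (ρ y) e)
fv-rename⁻ ρ (lam M) x e with fv-rename⁻ (ext ρ) M (suc x) e
... | suc y , f , q = y , f , cong pred q
fv-rename⁻ ρ (app M N) x e with fv-app⁻ (rename ρ M) (rename ρ N) e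
... | inj₁ e1 = let (y , f , q) = fv-rename⁻ ρ M x e1 in y , fv-appˡ M N f , q
... | inj₂ e2 = let (y , f , q) = fv-rename⁻ ρ N x e2 in y , fv-appʳ M N f , q

fv-rename⁺ : ∀ ρ M y → y ∈FV M → ρ y ∈FV rename ρ M
fv-rename⁺ ρ (var z) y e rewrite ≡ᵇ-sound y z e = ≡ᵇ-refl (ρ z)
fv-rename⁺ ρ (lam M) y e = fv-rename⁺ (ext ρ) M (suc y) e
fv-rename⁺ ρ (app M N) y e with fv-app⁻ M N e
... | inj₁ e1 = fv-appˡ (rename ρ M) (rename ρ N) (fv-rename⁺ ρ M y e1)
... | inj₂ e2 = fv-appʳ (rename ρ M) (rename ρ N) (fv-rename⁺ ρ N y e2)

fv-subst⁻ : ∀ σ M x → x ∈FV subst σ M → ∃ λ y → y ∈FV M × x ∈FV σ y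
fv-subst⁻ σ (var y) x e = y , ≡ᵇ-refl y , e
fv-subst⁻ σ (lam M) x e with fv-subst⁻ (exts σ) M (suc x) e
... | suc y , f , g = y , f , (let (z , h , q) = fv-rename⁻ suc (σ y) (suc x) g in
                                transport (_∈FV σ y) (cong pred q) h)
fv-subst⁻ σ (app M N) x e with fv-app⁻ (subst σ M) (subst σ N) e
... | inj₁ e1 = let (y , f , q) = fv-subst⁻ σ M x e1 in y , fv-appˡ M N f , q
... | inj₂ e2 = let (y , f , q) = fv-subst⁻ σ N x e2 in y , fv-appʳ M N f , q

lam* : ∀ {M N} → M ▷β* N → lam M ▷β* lam N
lam* = gmap lam ξlam

app* : ∀ {M M' N N'} → M ▷β* M' → N ▷β* N' → app M N ▷β* app M' N'
app* {M' = M'} {N = N} r₁ r₂ = gmap (λ K → app K N) ξl r₁ ◅◅ gmap (app M') ξr r₂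

fv-▷ : ∀ {M N} x → M ▷β N → x ∈FV N → x ∈FV M
fv-▷ {app (lam M) N} x β e with fv-subst⁻ (single N) M x e
... | zero  , f , g = fv-appʳ (lam M) N g
... | suc y , f , g rewrite ≡ᵇ-sound x y g = fv-appˡ (lam M) N f
fv-▷ x (ξlam s) e = fv-▷ (suc x) s e
fv-▷ x (ξl {M} {M'} {N} s) e with fv-app⁻ M' N e
... | inj₁ e1 = fv-appˡ M N (fv-▷ x s e1)
... | inj₂ e2 = fv-appʳ M N e2
fv-▷ x (ξr {M} {N} {N'} s) e with fv-app⁻ M N' e
... | inj₁ e1 = fv-appˡ M N e1
... | inj₂ e2 = fv-appʳ M N (fv-▷ x s e2)

fv-▷* : ∀ {M N} x → M ▷β* N → x ∈FV N → x ∈FV M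
fv-▷* x ε       e = e
fv-▷* x (s ◅ r) e = fv-▷ x s (fv-▷* x r e)

closed-▷* : ∀ {M N} → M ▷β* N → Closed M → Closed N
closed-▷* {M} {N} r c = closed-by-fv {N} (λ x e → ∈FV-contra {x} {M} (fv-▷* x r e) (c x))

rename-reflects-▷ : ∀ ρ M {R} → rename ρ M ▷β R → ∃ λ M' → (M ▷β M') × rename ρ M' ≡ R
rename-reflects-▷ ρ (lam M) (ξlam s) =
  let (M' , s' , e) = rename-reflects-▷ (ext ρ) M s in lam M' , ξlam s' , cong lam e
rename-reflects-▷ ρ (app (lam M) N) β = M [0≔ N ] , β , rename-commute ρ M N
rename-reflects-▷ ρ (app M N) (ξr s) =
  let (N' , s' , e) = rename-reflects-▷ ρ N s in app M N' , ξr s' , cong (app (rename ρ M)) e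
rename-reflects-▷ ρ (app M N) (ξl s) =
  let (M' , s' , e) = rename-reflects-▷ ρ M s in app M' N , ξl s' , cong (λ K → app K (rename ρ N)) e

rename-reflects-▷* : ∀ ρ M {R} → rename ρ M ▷β* R → ∃ λ M' → (M ▷β* M') × rename ρ M' ≡ R
rename-reflects-▷* ρ M ε = M , ε , refl
rename-reflects-▷* ρ M (s ◅ r) with rename-reflects-▷ ρ M s
... | M₁ , s₁ , refl = let (M' , r' , e) = rename-reflects-▷* ρ M₁ r in M' , s₁ ◅ r' , e

record AbstractionOf (M N : Term) (x : ℕ) : Set where
  constructor abstraction
  field
    body       : Term
    reduces    : M ▷β* lam body
    renames-to : rename (bind0 x) body ≡ N

instantiated-abstraction : ∀ {x N} P → (P [0≔ var x ]) ▷β* N → AbstractionOf (lam P) N x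
instantiated-abstraction {x} {N} P r
  with rename-reflects-▷* (bind0 x) P (transport (_▷β* N) (single-var-as-rename x P) r)
... | P' , r' , e = abstraction P' (lam* r') e

app-var-reduct : ∀ {M x N} → app M (var x) ▷β* N →
  (∃ λ M' → (M ▷β* M') × N ≡ app M' (var x)) ⊎ AbstractionOf M N x
app-var-reduct {M} ε = inj₁ (M , ε , refl)
app-var-reduct (β {P} ◅ r) = inj₂ (instantiated-abstraction P r)
app-var-reduct (ξl s ◅ r) with app-var-reduct r
... | inj₁ (M' , r' , e)        = inj₁ (M' , s ◅ r' , e)
... | inj₂ (abstraction P r' e) = inj₂ (abstraction P (s ◅ r') e)
app-var-reduct (ξr () ◅ r)

-- Confluence of β (Tait–Martin-Löf parallel reduction, Takahashi's method)

data _⇛_ : Term → Term → Set where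
  pvar  : ∀ {x} → var x ⇛ var x
  plam  : ∀ {M M'} → M ⇛ M' → lam M ⇛ lam M'
  papp  : ∀ {M M' N N'} → M ⇛ M' → N ⇛ N' → app M N ⇛ app M' N'
  pbeta : ∀ {M M' N N'} → M ⇛ M' → N ⇛ N' → app (lam M) N ⇛ (M' [0≔ N' ])

⇛-refl : ∀ M → M ⇛ M
⇛-refl (var x)   = pvar
⇛-refl (lam M)   = plam (⇛-refl M)
⇛-refl (app M N) = papp (⇛-refl M) (⇛-refl N)

▷⇒⇛ : ∀ {M N} → M ▷β N → M ⇛ N
▷⇒⇛ {app (lam M) N} β = pbeta (⇛-refl M) (⇛-refl N)
▷⇒⇛ (ξlam s)          = plam (▷⇒⇛ s)
▷⇒⇛ {app M N} (ξl s)  = papp (▷⇒⇛ s) (⇛-refl N)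
▷⇒⇛ {app M N} (ξr s)  = papp (⇛-refl M) (▷⇒⇛ s)

⇛⇒▷* : ∀ {M N} → M ⇛ N → M ▷β* N
⇛⇒▷* pvar        = ε
⇛⇒▷* (plam p)    = lam* (⇛⇒▷* p)
⇛⇒▷* (papp p q)  = app* (⇛⇒▷* p) (⇛⇒▷* q)
⇛⇒▷* (pbeta p q) = app* (lam* (⇛⇒▷* p)) (⇛⇒▷* q) ◅◅ (β ◅ ε)

⇛-rename : ∀ ρ {M N} → M ⇛ N → rename ρ M ⇛ rename ρ N
⇛-rename ρ pvar       = pvar
⇛-rename ρ (plam p)   = plam (⇛-rename (ext ρ) p)
⇛-rename ρ (papp p q) = papp (⇛-rename ρ p) (⇛-rename ρ q)
⇛-rename ρ (pbeta {M} {M'} {N} {N'} p q) = transport (rename ρ (app (lam M) N) ⇛_)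
  (sym (rename-commute ρ M' N')) (pbeta (⇛-rename (ext ρ) p) (⇛-rename ρ q))

⇛-exts : ∀ {σ τ} → (∀ x → σ x ⇛ τ x) → ∀ x → exts σ x ⇛ exts τ x
⇛-exts h zero    = pvar
⇛-exts h (suc x) = ⇛-rename suc (h x)

⇛-subst : ∀ {σ τ} → (∀ x → σ x ⇛ τ x) → ∀ {M N} → M ⇛ N → subst σ M ⇛ subst τ N
⇛-subst h (pvar {x}) = h x
⇛-subst h (plam p)   = plam (⇛-subst (⇛-exts h) p)
⇛-subst h (papp p q) = papp (⇛-subst h p) (⇛-subst h q)
⇛-subst {σ} {τ} h (pbeta {M} {M'} {N} {N'} p q) = transport (subst σ (app (lam M) N) ⇛_)
  (sym (subst-commute τ M' N')) (pbeta (⇛-subst (⇛-exts h) p) (⇛-subst h q))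

⇛-single : ∀ {M M' N N'} → M ⇛ M' → N ⇛ N' → (M [0≔ N ]) ⇛ (M' [0≔ N' ])
⇛-single {N = N} {N'} p q = ⇛-subst single⇛ p
  where single⇛ : ∀ x → single N x ⇛ single N' x
        single⇛ zero    = q
        single⇛ (suc x) = pvar

develop : Term → Term
develop (var x)            = var x
develop (lam M)            = lam (develop M)
develop (app (lam M) N)    = develop M [0≔ develop N ]
develop (app (var x) N)    = app (var x) (develop N)
develop (app (app M M') N) = app (develop (app M M')) (develop N)

triangle : ∀ {M N} → M ⇛ N → N ⇛ develop M
triangle pvar                      = pvar
triangle (plam p)                  = plam (triangle p)
triangle (pbeta p q)               = ⇛-single (triangle p) (triangle q)
triangle (papp (plam p) q)         = pbeta (triangle p) (triangle q)
triangle (papp {var x} p q)        = papp (triangle p) (triangle q)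
triangle (papp {app M M'} p q)     = papp (triangle p) (triangle q)

strip : ∀ {M N P} → M ⇛ N → Star _⇛_ M P → ∃ λ Q → Star _⇛_ N Q × (P ⇛ Q)
strip {N = N} p ε = N , ε , p
strip p (q ◅ r) = let (Q , r' , s) = strip (triangle q) r in Q , triangle p ◅ r' , s

⇛*-confluent : ∀ {M N P} → Star _⇛_ M N → Star _⇛_ M P → ∃ λ Q → Star _⇛_ N Q × Star _⇛_ P Q
⇛*-confluent {P = P} ε r = P , r , ε
⇛*-confluent (p ◅ r₁) r₂ =
  let (Q₁ , r₃ , s) = strip p r₂ ; (Q , r₄ , r₅) = ⇛*-confluent r₁ r₃ in Q , r₄ , s ◅ r₅

confluence : ∀ {M N P} → M ▷β* N → M ▷β* P → ∃ λ Q → (N ▷β* Q) × (P ▷β* Q)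
confluence r₁ r₂ =
  let (Q , a , b) = ⇛*-confluent (gmap id ▷⇒⇛ r₁) (gmap id ▷⇒⇛ r₂)
  in Q , kleisliStar id ⇛⇒▷* a , kleisliStar id ⇛⇒▷* b

-- An intersection type is determined, up to ⊑, by the list of its arrow and
-- atom components; U ⊑ V holds exactly when every component of V is above
-- some component of U in the structural order _≤T_.

components : UTy → List Ty
components ω       = []
components (U ⊓ V) = components U ++ components V
components (↑ T)   = T ∷ []

_≤T_ : Ty → Ty → Set
atom a  ≤T atom b    = a ≡ b
atom a  ≤T (U ⇒ T)   = ⊥
(U ⇒ T) ≤T atom b    = ⊥
(U ⇒ T) ≤T (U' ⇒ T') = (U' ⊑ U) × (T ≤T T')

⊑refl : ∀ {U} → U ⊑ U
⊑refl = ⊑≈ ≈refl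

≤T-refl : ∀ T → T ≤T T
≤T-refl (atom a) = refl
≤T-refl (U ⇒ T)  = ⊑refl , ≤T-refl T

≤T-trans : ∀ T₁ T₂ T₃ → T₁ ≤T T₂ → T₂ ≤T T₃ → T₁ ≤T T₃
≤T-trans (atom a)  (atom b)  (atom c)  refl refl = refl
≤T-trans (U₁ ⇒ T₁) (U₂ ⇒ T₂) (U₃ ⇒ T₃) (a , b) (c , d) = ⊑trans c a , ≤T-trans T₁ T₂ T₃ b d

≤T⇒⊑ : ∀ T T' → T ≤T T' → (↑ T) ⊑ (↑ T')
≤T⇒⊑ (atom a) (atom b)   refl    = ⊑refl
≤T⇒⊑ (U ⇒ T) (U' ⇒ T') (a , b) = ⊑⇒ a (≤T⇒⊑ T T' b)

record _⊑ᶜ_ (U V : UTy) : Set where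
  constructor by-components
  field below : ∀ T' → T' ∈ components V → ∃ λ T → T ∈ components U × T ≤T T'
open _⊑ᶜ_

⊑ᶜ-⊆ : ∀ {U V} → (∀ {T} → T ∈ components V → T ∈ components U) → U ⊑ᶜ V
⊑ᶜ-⊆ h = by-components λ T m → T , h m , ≤T-refl T

⊑ᶜ-trans : ∀ {U V W} → U ⊑ᶜ V → V ⊑ᶜ W → U ⊑ᶜ W
below (⊑ᶜ-trans p q) T m =
  let (T₁ , m₁ , l₁) = below q T m ; (T₀ , m₀ , l₀) = below p T₁ m₁
  in T₀ , m₀ , ≤T-trans T₀ T₁ T l₀ l₁

⊑ᶜ-⊓ : ∀ {U U' V V'} → U ⊑ᶜ U' → V ⊑ᶜ V' → (U ⊓ V) ⊑ᶜ (U' ⊓ V')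
below (⊑ᶜ-⊓ {U} {U'} p q) T m with ∈-++⁻ (components U') m
... | inj₁ m₁ = let (T₀ , m₀ , l) = below p T m₁ in T₀ , ∈-++⁺ˡ m₀ , l
... | inj₂ m₂ = let (T₀ , m₀ , l) = below q T m₂ in T₀ , ∈-++⁺ʳ (components U) m₀ , l

⊑ᶜ-single : ∀ {T T'} → (↑ T) ⊑ᶜ (↑ T') → T ≤T T'
⊑ᶜ-single {T} {T'} p with below p T' (here refl)
... | .T , here refl , l = l

⊑ᶜ-arrow : ∀ {U₁ U₂ T₁ T₂} → U₂ ⊑ U₁ → T₁ ≤T T₂ → (↑ (U₁ ⇒ T₁)) ⊑ᶜ (↑ (U₂ ⇒ T₂))
⊑ᶜ-arrow {U₁} {T₁ = T₁} p q = by-components λ { _ (here refl) → U₁ ⇒ T₁ , here refl , (p , q) }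

≈⇒⊑ᶜ : ∀ {U V} → U ≈ V → (U ⊑ᶜ V) × (V ⊑ᶜ U)
≈⇒⊑ᶜ ≈refl        = ⊑ᶜ-⊆ id , ⊑ᶜ-⊆ id
≈⇒⊑ᶜ (≈sym e)     = let (a , b) = ≈⇒⊑ᶜ e in b , a
≈⇒⊑ᶜ (≈trans e f) = let (a , b) = ≈⇒⊑ᶜ e ; (c , d) = ≈⇒⊑ᶜ f in ⊑ᶜ-trans a c , ⊑ᶜ-trans d b
≈⇒⊑ᶜ (≈⊓ e f)     = let (a , b) = ≈⇒⊑ᶜ e ; (c , d) = ≈⇒⊑ᶜ f in ⊑ᶜ-⊓ a c , ⊑ᶜ-⊓ b d
≈⇒⊑ᶜ (≈⇒ e f)     = let (a , b) = ≈⇒⊑ᶜ f in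
  ⊑ᶜ-arrow (⊑≈ (≈sym e)) (⊑ᶜ-single a) , ⊑ᶜ-arrow (⊑≈ e) (⊑ᶜ-single b)
≈⇒⊑ᶜ (≈comm {U} {V}) =
  ⊑ᶜ-⊆ (∈-resp-↭ (++-comm (components V) (components U))) ,
  ⊑ᶜ-⊆ (∈-resp-↭ (++-comm (components U) (components V)))
≈⇒⊑ᶜ (≈assoc {U} {V} {W}) =
  ⊑ᶜ-⊆ (transport (_ ∈_) (sym (++-assoc (components U) (components V) (components W)))) ,
  ⊑ᶜ-⊆ (transport (_ ∈_) (++-assoc (components U) (components V) (components W)))
≈⇒⊑ᶜ (≈idem {U}) = ⊑ᶜ-⊆ ∈-++⁺ˡ , ⊑ᶜ-⊆ (λ m → [ id , id ] (∈-++⁻ (components U) m))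
≈⇒⊑ᶜ ≈unit       = ⊑ᶜ-⊆ id , ⊑ᶜ-⊆ id

⊑⇒⊑ᶜ : ∀ {U V} → U ⊑ V → U ⊑ᶜ V
⊑⇒⊑ᶜ (⊑≈ e)       = proj₁ (≈⇒⊑ᶜ e)
⊑⇒⊑ᶜ (⊑trans p q) = ⊑ᶜ-trans (⊑⇒⊑ᶜ p) (⊑⇒⊑ᶜ q)
⊑⇒⊑ᶜ ⊑⊓l          = ⊑ᶜ-⊆ ∈-++⁺ˡ
⊑⇒⊑ᶜ (⊑⊓ p q)     = ⊑ᶜ-⊓ (⊑⇒⊑ᶜ p) (⊑⇒⊑ᶜ q)
⊑⇒⊑ᶜ (⊑⇒ p q)     = ⊑ᶜ-arrow p (⊑ᶜ-single (⊑⇒⊑ᶜ q))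

⊑⊓r : ∀ {U V} → (U ⊓ V) ⊑ V
⊑⊓r = ⊑trans (⊑≈ ≈comm) ⊑⊓l

⊑ω : ∀ {U} → U ⊑ ω
⊑ω = ⊑trans (⊑≈ (≈trans (≈sym ≈unit) ≈comm)) ⊑⊓r

⊑-glb : ∀ {W A B} → W ⊑ A → W ⊑ B → W ⊑ (A ⊓ B)
⊑-glb p q = ⊑trans (⊑≈ (≈sym ≈idem)) (⊑⊓ p q)

⊑-component : ∀ U {T} → T ∈ components U → U ⊑ (↑ T)
⊑-component (U ⊓ V) m with ∈-++⁻ (components U) m
... | inj₁ a = ⊑trans ⊑⊓l (⊑-component U a)
... | inj₂ b = ⊑trans ⊑⊓r (⊑-component V b)
⊑-component (↑ T') (here refl) = ⊑refl

⊑-by-components : ∀ W V → (∀ T → T ∈ components V → W ⊑ (↑ T)) → W ⊑ V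
⊑-by-components W ω       h = ⊑ω
⊑-by-components W (U ⊓ V) h = ⊑-glb (⊑-by-components W U (λ T m → h T (∈-++⁺ˡ m)))
                                    (⊑-by-components W V (λ T m → h T (∈-++⁺ʳ (components U) m)))
⊑-by-components W (↑ T)   h = h T (here refl)

-- Γ ≼ Δ : Γ is at least as informative as Δ (each declaration of Δ is
-- refined in Γ); unlike _⊑ₑ_, Γ may declare more variables.
_≼_ : Env → Env → Set
Γ ≼ Δ = ∀ x A → Δ x ≡ just A → ∃ λ B → Γ x ≡ just B × B ⊑ A

≼-trans : ∀ {Γ₁ Γ₂ Γ₃} → Γ₁ ≼ Γ₂ → Γ₂ ≼ Γ₃ → Γ₁ ≼ Γ₃
≼-trans p q x A e =
  let (B , e₂ , l) = q x A e ; (C , e₁ , l') = p x B e₂ in C , e₁ , ⊑trans l' l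

just-inj : ∀ {A B : UTy} → _≡_ {A = Maybe UTy} (just A) (just B) → A ≡ B
just-inj refl = refl

pointwise-just : ∀ {m₁ m₂ A} → Pointwise _⊑_ m₁ m₂ → m₂ ≡ just A → ∃ λ B → m₁ ≡ just B × B ⊑ A
pointwise-just (just r) refl = _ , refl , r

pointwise-nothing : ∀ {m₁ m₂} → Pointwise _⊑_ m₁ m₂ → m₂ ≡ nothing → m₁ ≡ nothing
pointwise-nothing nothing refl = refl

⊑ₑ⇒≼ : ∀ {Γ' Γ} → Γ' ⊑ₑ Γ → Γ' ≼ Γ
⊑ₑ⇒≼ p x A e = pointwise-just (p x) e

⊑ₑ-refl : ∀ {Γ} → Γ ⊑ₑ Γ
⊑ₑ-refl {Γ} x with Γ x
... | just A  = just ⊑refl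
... | nothing = nothing

meet≼ˡ : ∀ {Γ₁ Γ₂} → (Γ₁ ⊓ₑ Γ₂) ≼ Γ₁
meet≼ˡ {Γ₁} {Γ₂} x A e with Γ₁ x | Γ₂ x
meet≼ˡ x A refl | just .A | just A' = A ⊓ A' , refl , ⊑⊓l
meet≼ˡ x A refl | just .A | nothing = A , refl , ⊑refl

meet≼ʳ : ∀ {Γ₁ Γ₂} → (Γ₁ ⊓ₑ Γ₂) ≼ Γ₂
meet≼ʳ {Γ₁} {Γ₂} x A e with Γ₁ x | Γ₂ x
meet≼ʳ x A refl | just A' | just .A = A' ⊓ A , refl , ⊑⊓r
meet≼ʳ x A refl | nothing | just .A = A , refl , ⊑refl

meet-definedˡ : ∀ {m} m' {A} → m ≡ just A → ∃ λ B → meetM m m' ≡ just B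
meet-definedˡ (just A') refl = _ , refl
meet-definedˡ nothing   refl = _ , refl

meet-definedʳ : ∀ m {m' A} → m' ≡ just A → ∃ λ B → meetM m m' ≡ just B
meet-definedʳ (just A) refl = _ , refl
meet-definedʳ nothing  refl = _ , refl

_∷ₑ_ : UTy → Env → Env
(U ∷ₑ Γ) zero    = just U
(U ∷ₑ Γ) (suc n) = Γ n

∷-≼ : ∀ {U Γ Δ} → Γ ≼ Δ → (U ∷ₑ Γ) ≼ (U ∷ₑ Δ)
∷-≼ p zero    A refl = A , refl , ⊑refl
∷-≼ p (suc x) A e    = p x A e

single-env-self : ∀ x A → single-env x A x ≡ just A
single-env-self x A rewrite ≡ᵇ-refl x = refl

typed-fv-declared : ∀ {M Δ U} → M ⦂⟨ Δ ⊢ U ⟩ → ∀ x → x ∈FV M → ∃ λ A → Δ x ≡ just A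
typed-fv-declared (ax x T) y e rewrite ≡ᵇ-sound y x e = _ , single-env-self x (↑ T)
typed-fv-declared (ωr M) y e rewrite e = _ , refl
typed-fv-declared (→i d _) y e = typed-fv-declared d (suc y) e
typed-fv-declared (→i' d _) y e = typed-fv-declared d (suc y) e
typed-fv-declared (→e {Γ₁} {Γ₂} {M₁} {M₂} d₁ d₂) y e with fv-app⁻ M₁ M₂ e
... | inj₁ e₁ = meet-definedˡ (Γ₂ y) (proj₂ (typed-fv-declared d₁ y e₁))
... | inj₂ e₂ = meet-definedʳ (Γ₁ y) (proj₂ (typed-fv-declared d₂ y e₂))
typed-fv-declared (⊓i d₁ d₂) y e = typed-fv-declared d₁ y e
typed-fv-declared (⊑r d s p) y e =
  let (A , eA) = typed-fv-declared d y e ; (B , eB , _) = pointwise-just (p y) eA in B , eB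

untyped-if-not-free : ∀ {M Δ U} → M ⦂⟨ Δ ⊢ U ⟩ → ∀ x → fv x M ≡ false → Δ x ≡ nothing
untyped-if-not-free (ax x T) y e rewrite ≡ᵇ-sym x y | e = refl
untyped-if-not-free (ωr M) y e rewrite e = refl
untyped-if-not-free (→i d _) y e = untyped-if-not-free d (suc y) e
untyped-if-not-free (→i' d _) y e = untyped-if-not-free d (suc y) e
untyped-if-not-free (→e {Γ₁} {Γ₂} {M₁} d₁ d₂) y e
  rewrite untyped-if-not-free d₁ y (∨-conicalˡ (fv y M₁) _ e)
        | untyped-if-not-free d₂ y (∨-conicalʳ (fv y M₁) _ e) = refl
untyped-if-not-free (⊓i d₁ d₂) y e = untyped-if-not-free d₁ y e
untyped-if-not-free (⊑r d s p) y e = pointwise-nothing (p y) (untyped-if-not-free d y e)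

-- This relation
-- is closed under refining Γ, which the rules themselves (whose environments
-- are exactly FV(M)) are not; it makes every typing rule admissible with a
-- single shared environment.

infix 4 _⊢_∶_
_⊢_∶_ : Env → Term → UTy → Set
Γ ⊢ M ∶ U = ∃ λ Δ → (M ⦂⟨ Δ ⊢ U ⟩) × Γ ≼ Δ

Covers : Env → Term → Set
Covers Γ M = ∀ x → x ∈FV M → ∃ λ A → Γ x ≡ just A

⊢-covers : ∀ {Γ M U} → Γ ⊢ M ∶ U → Covers Γ M
⊢-covers (Δ , d , h) x e =
  let (A , eA) = typed-fv-declared d x e ; (B , eB , _) = h x A eA in B , eB

⊢-sub : ∀ {Γ M U V} → Γ ⊢ M ∶ U → U ⊑ V → Γ ⊢ M ∶ V
⊢-sub (Δ , d , h) s = Δ , ⊑r d s ⊑ₑ-refl , h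

⊢-refine : ∀ {Γ Γ' M U} → Γ' ≼ Γ → Γ ⊢ M ∶ U → Γ' ⊢ M ∶ U
⊢-refine p (Δ , d , h) = Δ , d , ≼-trans p h

⊢-ω : ∀ {Γ M} → Covers Γ M → Γ ⊢ M ∶ ω
⊢-ω {Γ} {M} c = envω M , ωr M , h
  where h : Γ ≼ envω M
        h x A e with fv x M in eq
        h x A refl | true = let (B , eB) = c x eq in B , eB , ⊑ω

restrict : Env → Term → Env
restrict Γ M x = if fv x M then Γ x else nothing

restrict-≼ : ∀ {Γ M} → Γ ≼ restrict Γ M
restrict-≼ {Γ} {M} x A e with fv x M
... | true = A , e , ⊑refl

restrict-typing : ∀ {Γ M U} → Γ ⊢ M ∶ U → M ⦂⟨ restrict Γ M ⊢ U ⟩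
restrict-typing {Γ} {M} (Δ , d , h) = ⊑r d ⊑refl restrict⊑ₑ
  where pointwise-from : ∀ {m₁ m₂ B A} → m₁ ≡ just B → m₂ ≡ just A → B ⊑ A → Pointwise _⊑_ m₁ m₂
        pointwise-from refl refl l = just l
        restrict⊑ₑ : restrict Γ M ⊑ₑ Δ
        restrict⊑ₑ x with fv x M in eq
        ... | true  = let (A , eA) = typed-fv-declared d x eq ; (B , eB , l) = h x A eA in
                      pointwise-from eB eA l
        ... | false rewrite untyped-if-not-free d x eq = nothing

closed-typing : ∀ {Γ N U} → Γ ⊢ N ∶ U → Closed N → N ⦂⟨ emptyEnv ⊢ U ⟩
closed-typing {Γ} {N} t c = ⊑r (restrict-typing t) ⊑refl empty⊑ₑ
  where empty⊑ₑ : emptyEnv ⊑ₑ restrict Γ N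
        empty⊑ₑ x rewrite c x = nothing

⊢-⊓ : ∀ {Γ M U V} → Γ ⊢ M ∶ U → Γ ⊢ M ∶ V → Γ ⊢ M ∶ U ⊓ V
⊢-⊓ {Γ} {M} t₁ t₂ = restrict Γ M , ⊓i (restrict-typing t₁) (restrict-typing t₂) , restrict-≼ {Γ} {M}

⊢-app : ∀ {Γ M N U T} → Γ ⊢ M ∶ ↑ (U ⇒ T) → Γ ⊢ N ∶ U → Γ ⊢ app M N ∶ ↑ T
⊢-app {Γ} (Δ₁ , d₁ , h₁) (Δ₂ , d₂ , h₂) = Δ₁ ⊓ₑ Δ₂ , →e d₁ d₂ , h
  where h : Γ ≼ (Δ₁ ⊓ₑ Δ₂)
        h x C e with Δ₁ x in e₁ | Δ₂ x in e₂
        h x C refl | just A | just A' =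
          let (B , eB , l) = h₁ x A e₁ ; (B' , eB' , l') = h₂ x A' e₂
          in B , eB , ⊑-glb l (transport (_⊑ A') (just-inj (trans (sym eB') eB)) l')
        h x C refl | just A  | nothing = h₁ x A e₁
        h x C refl | nothing | just A' = h₂ x A' e₂

⊢-lam : ∀ {Γ M U T} → (U ∷ₑ Γ) ⊢ M ∶ ↑ T → Γ ⊢ lam M ∶ ↑ (U ⇒ T)
⊢-lam {Γ} {M} {U} {T} (Δ , d , h) with Δ zero in e
... | just A  = let (B , eB , l) = h zero A e in
   tailEnv Δ , ⊑r (→i d e) (⊑⇒ (transport (_⊑ A) (sym (just-inj eB)) l) ⊑refl) ⊑ₑ-refl , (λ x → h (suc x))
... | nothing = tailEnv Δ , ⊑r (→i' d e) (⊑⇒ ⊑ω ⊑refl) ⊑ₑ-refl , (λ x → h (suc x))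

var-typing : ∀ x A → var x ⦂⟨ single-env x A ⊢ A ⟩
var-typing x ω = ⊑r (ωr (var x)) ⊑refl single⊑ₑ
  where single⊑ₑ : single-env x ω ⊑ₑ envω (var x)
        single⊑ₑ y rewrite ≡ᵇ-sym y x with x ≡ᵇ y
        ... | true  = just ⊑refl
        ... | false = nothing
var-typing x (A ⊓ B) = ⊓i (⊑r (var-typing x A) ⊑refl (single⊑ₑ ⊑⊓l)) (⊑r (var-typing x B) ⊑refl (single⊑ₑ ⊑⊓r))
  where single⊑ₑ : ∀ {C} → (A ⊓ B) ⊑ C → single-env x (A ⊓ B) ⊑ₑ single-env x C
        single⊑ₑ l y with x ≡ᵇ y
        ... | true  = just l
        ... | false = nothing
var-typing x (↑ T) = ax x T

⊢-var : ∀ {Γ x A} → Γ x ≡ just A → Γ ⊢ var x ∶ A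
⊢-var {Γ} {x} {A} e = single-env x A , var-typing x A , declared
  where declared : Γ ≼ single-env x A
        declared y C e' with x ≡ᵇ y in eq
        declared y C refl | true rewrite ≡ᵇ-sound x y eq = C , e , ⊑refl

gen-app : ∀ {M N Δ W} → app M N ⦂⟨ Δ ⊢ W ⟩ → ∀ T → T ∈ components W →
  ∃ λ U → ∃ λ T' → (Δ ⊢ M ∶ ↑ (U ⇒ T')) × (Δ ⊢ N ∶ U) × T' ≤T T
gen-app (→e d₁ d₂) T (here refl) = _ , T , (_ , d₁ , meet≼ˡ) , (_ , d₂ , meet≼ʳ) , ≤T-refl T
gen-app (⊓i {U₁ = U₁} d₁ d₂) T m with ∈-++⁻ (components U₁) m
... | inj₁ a = gen-app d₁ T a
... | inj₂ b = gen-app d₂ T b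
gen-app (⊑r d s p) T m =
  let (T₀ , m₀ , l) = below (⊑⇒⊑ᶜ s) T m ; (U , T' , t₁ , t₂ , l') = gen-app d T₀ m₀
  in U , T' , ⊢-refine (⊑ₑ⇒≼ p) t₁ , ⊢-refine (⊑ₑ⇒≼ p) t₂ , ≤T-trans T' T₀ T l' l

gen-lam : ∀ {M Δ W} → lam M ⦂⟨ Δ ⊢ W ⟩ → ∀ T → T ∈ components W →
  ∃ λ U → ∃ λ T' → ((U ∷ₑ Δ) ⊢ M ∶ ↑ T') × (U ⇒ T') ≤T T
gen-lam (→i {Γ} {M} {U} {T} d e) _ (here refl) = U , T , (Γ , d , h) , (⊑refl , ≤T-refl T)
  where h : (U ∷ₑ tailEnv Γ) ≼ Γ
        h zero    A e' = U , refl , transport (U ⊑_) (just-inj (trans (sym e) e')) ⊑refl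
        h (suc x) A e' = A , e' , ⊑refl
gen-lam (→i' {Γ} {M} {T} d e) _ (here refl) = ω , T , (Γ , d , h) , (⊑refl , ≤T-refl T)
  where h : (ω ∷ₑ tailEnv Γ) ≼ Γ
        h zero    A e' with trans (sym e) e'
        ... | ()
        h (suc x) A e' = A , e' , ⊑refl
gen-lam (⊓i {U₁ = U₁} d₁ d₂) T m with ∈-++⁻ (components U₁) m
... | inj₁ a = gen-lam d₁ T a
... | inj₂ b = gen-lam d₂ T b
gen-lam (⊑r d s p) T m =
  let (T₀ , m₀ , l) = below (⊑⇒⊑ᶜ s) T m ; (U , T' , t , l') = gen-lam d T₀ m₀
  in U , T' , ⊢-refine (∷-≼ (⊑ₑ⇒≼ p)) t , ≤T-trans (U ⇒ T') T₀ T l' l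

gen-var : ∀ {x Δ W} → var x ⦂⟨ Δ ⊢ W ⟩ → ∀ T → T ∈ components W → ∃ λ A → Δ x ≡ just A × A ⊑ (↑ T)
gen-var (ax x T) _ (here refl) = ↑ T , single-env-self x (↑ T) , ⊑refl
gen-var (⊓i {U₁ = U₁} d₁ d₂) T m with ∈-++⁻ (components U₁) m
... | inj₁ a = gen-var d₁ T a
... | inj₂ b = gen-var d₂ T b
gen-var {x} (⊑r d s p) T m =
  let (T₀ , m₀ , l) = below (⊑⇒⊑ᶜ s) T m ; (A , eA , l') = gen-var d T₀ m₀
      (B , eB , l'') = pointwise-just (p x) eA
  in B , eB , ⊑trans l'' (⊑trans l' (≤T⇒⊑ T₀ T l))

⊢-gen-app : ∀ {Γ M N T} → Γ ⊢ app M N ∶ ↑ T →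
  ∃ λ U → ∃ λ T' → (Γ ⊢ M ∶ ↑ (U ⇒ T')) × (Γ ⊢ N ∶ U) × T' ≤T T
⊢-gen-app {T = T} (Δ , d , h) =
  let (U , T' , t₁ , t₂ , l) = gen-app d T (here refl) in U , T' , ⊢-refine h t₁ , ⊢-refine h t₂ , l

⊢-gen-lam : ∀ {Γ M T} → Γ ⊢ lam M ∶ ↑ T →
  ∃ λ U → ∃ λ T' → ((U ∷ₑ Γ) ⊢ M ∶ ↑ T') × (U ⇒ T') ≤T T
⊢-gen-lam {T = T} (Δ , d , h) =
  let (U , T' , t , l) = gen-lam d T (here refl) in U , T' , ⊢-refine (∷-≼ h) t , l

⊢-gen-var : ∀ {Γ x T} → Γ ⊢ var x ∶ ↑ T → ∃ λ A → Γ x ≡ just A × A ⊑ (↑ T)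
⊢-gen-var {x = x} {T} (Δ , d , h) =
  let (A , eA , l) = gen-var d T (here refl) ; (B , eB , l') = h x A eA in B , eB , ⊑trans l' l

⊢-component : ∀ {Γ M U T} → Γ ⊢ M ∶ U → T ∈ components U → Γ ⊢ M ∶ ↑ T
⊢-component {U = U} t m = ⊢-sub t (⊑-component U m)

⊢-by-components : ∀ {Γ M} U → Covers Γ M → (∀ T → T ∈ components U → Γ ⊢ M ∶ ↑ T) → Γ ⊢ M ∶ U
⊢-by-components ω       c h = ⊢-ω c
⊢-by-components (U ⊓ V) c h = ⊢-⊓ (⊢-by-components U c (λ T m → h T (∈-++⁺ˡ m)))
                                  (⊢-by-components V c (λ T m → h T (∈-++⁺ʳ (components U) m)))
⊢-by-components (↑ T)   c h = h T (here refl)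

RenamesInto : Env → Env → (ℕ → ℕ) → Set
RenamesInto Γ Δ ρ = ∀ x A → Γ x ≡ just A → ∃ λ B → Δ (ρ x) ≡ just B × B ⊑ A

renames-ext : ∀ {Γ Δ ρ} U → RenamesInto Γ Δ ρ → RenamesInto (U ∷ₑ Γ) (U ∷ₑ Δ) (ext ρ)
renames-ext U h zero    A e = A , e , ⊑refl
renames-ext U h (suc x) A e = h x A e

mutual
  ⊢-rename : ∀ {Γ Δ} ρ → RenamesInto Γ Δ ρ → ∀ M U → Γ ⊢ M ∶ U → Δ ⊢ rename ρ M ∶ U
  ⊢-rename {Γ} {Δ} ρ h M U t = ⊢-by-components U covers (λ T m → ⊢-rename-T ρ h M T (⊢-component t m))
    where covers : Covers Δ (rename ρ M)
          covers x e = let (y , fy , q) = fv-rename⁻ ρ M x e ; (A , eA) = ⊢-covers t y fy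
                           (B , eB , _) = h y A eA
                       in B , transport (λ z → Δ z ≡ just B) q eB

  ⊢-rename-T : ∀ {Γ Δ} ρ → RenamesInto Γ Δ ρ → ∀ M T → Γ ⊢ M ∶ ↑ T → Δ ⊢ rename ρ M ∶ ↑ T
  ⊢-rename-T ρ h (var x) T t =
    let (A , eA , l) = ⊢-gen-var t ; (B , eB , l') = h x A eA in ⊢-sub (⊢-var eB) (⊑trans l' l)
  ⊢-rename-T ρ h (lam M) T t = let (U , T' , t' , l) = ⊢-gen-lam t in
     ⊢-sub (⊢-lam (⊢-rename (ext ρ) (renames-ext U h) M (↑ T') t')) (≤T⇒⊑ (U ⇒ T') T l)
  ⊢-rename-T ρ h (app M N) T t = let (U , T' , t₁ , t₂ , l) = ⊢-gen-app t in
     ⊢-sub (⊢-app (⊢-rename-T ρ h M (U ⇒ T') t₁) (⊢-rename ρ h N U t₂)) (≤T⇒⊑ T' T l)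

SubstsInto : Env → Env → (ℕ → Term) → Set
SubstsInto Γ Δ σ = ∀ x A → Γ x ≡ just A → Δ ⊢ σ x ∶ A

substs-exts : ∀ {Γ Δ σ} U → SubstsInto Γ Δ σ → SubstsInto (U ∷ₑ Γ) (U ∷ₑ Δ) (exts σ)
substs-exts U h zero    A e = ⊢-var e
substs-exts {σ = σ} U h (suc x) A e = ⊢-rename suc (λ y B e' → B , e' , ⊑refl) (σ x) A (h x A e)

mutual
  ⊢-subst : ∀ {Γ Δ} σ → SubstsInto Γ Δ σ → ∀ M U → Γ ⊢ M ∶ U → Δ ⊢ subst σ M ∶ U
  ⊢-subst {Γ} {Δ} σ h M U t = ⊢-by-components U covers (λ T m → ⊢-subst-T σ h M T (⊢-component t m))
    where covers : Covers Δ (subst σ M)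
          covers x e = let (y , fy , fx) = fv-subst⁻ σ M x e ; (A , eA) = ⊢-covers t y fy
                       in ⊢-covers (h y A eA) x fx

  ⊢-subst-T : ∀ {Γ Δ} σ → SubstsInto Γ Δ σ → ∀ M T → Γ ⊢ M ∶ ↑ T → Δ ⊢ subst σ M ∶ ↑ T
  ⊢-subst-T σ h (var x) T t = let (A , eA , l) = ⊢-gen-var t in ⊢-sub (h x A eA) l
  ⊢-subst-T σ h (lam M) T t = let (U , T' , t' , l) = ⊢-gen-lam t in
     ⊢-sub (⊢-lam (⊢-subst (exts σ) (substs-exts U h) M (↑ T') t')) (≤T⇒⊑ (U ⇒ T') T l)
  ⊢-subst-T σ h (app M N) T t = let (U , T' , t₁ , t₂ , l) = ⊢-gen-app t in
     ⊢-sub (⊢-app (⊢-subst-T σ h M (U ⇒ T') t₁) (⊢-subst σ h N U t₂)) (≤T⇒⊑ T' T l)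

substs-single : ∀ {Γ Q U} → Γ ⊢ Q ∶ U → SubstsInto (U ∷ₑ Γ) Γ (single Q)
substs-single t zero    A refl = t
substs-single t (suc x) A e    = ⊢-var e

mutual
  subject-reduction : ∀ {Γ M N} U → Γ ⊢ M ∶ U → M ▷β N → Γ ⊢ N ∶ U
  subject-reduction U t s =
    ⊢-by-components U (λ x e → ⊢-covers t x (fv-▷ x s e)) (λ T m → subject-reduction-T T (⊢-component t m) s)

  subject-reduction-T : ∀ {Γ M N} T → Γ ⊢ M ∶ ↑ T → M ▷β N → Γ ⊢ N ∶ ↑ T
  subject-reduction-T T t (β {P} {Q}) =
    let (U , T' , t₁ , t₂ , l) = ⊢-gen-app t ; (U₂ , T₂ , t₃ , (l₁ , l₂)) = ⊢-gen-lam t₁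
    in ⊢-sub (⊢-subst (single Q) (substs-single (⊢-sub t₂ l₁)) P (↑ T₂) t₃) (≤T⇒⊑ T₂ T (≤T-trans T₂ T' T l₂ l))
  subject-reduction-T T t (ξlam s) = let (U , T' , t' , l) = ⊢-gen-lam t in
    ⊢-sub (⊢-lam (subject-reduction-T T' t' s)) (≤T⇒⊑ (U ⇒ T') T l)
  subject-reduction-T T t (ξl s) = let (U , T' , t₁ , t₂ , l) = ⊢-gen-app t in
    ⊢-sub (⊢-app (subject-reduction-T (U ⇒ T') t₁ s) t₂) (≤T⇒⊑ T' T l)
  subject-reduction-T T t (ξr s) = let (U , T' , t₁ , t₂ , l) = ⊢-gen-app t in
    ⊢-sub (⊢-app t₁ (subject-reduction U t₂ s)) (≤T⇒⊑ T' T l)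

subject-reduction* : ∀ {Γ M N} U → Γ ⊢ M ∶ U → M ▷β* N → Γ ⊢ N ∶ U
subject-reduction* U t ε       = t
subject-reduction* U t (s ◅ r) = subject-reduction* U (subject-reduction U t s) r

⟦≈⟧ : ∀ {U V} → U ≈ V → ∀ I M → (⟦ U ⟧ I M → ⟦ V ⟧ I M) × (⟦ V ⟧ I M → ⟦ U ⟧ I M)
⟦≈⟧ ≈refl        I M = id , id
⟦≈⟧ (≈sym e)     I M = let (a , b) = ⟦≈⟧ e I M in b , a
⟦≈⟧ (≈trans e f) I M = let (a , b) = ⟦≈⟧ e I M ; (c , d) = ⟦≈⟧ f I M in (λ z → c (a z)) , (λ z → b (d z))
⟦≈⟧ (≈⊓ e f)     I M = let (a , b) = ⟦≈⟧ e I M ; (c , d) = ⟦≈⟧ f I M in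
  (λ { (x , y) → a x , c y }) , (λ { (x , y) → b x , d y })
⟦≈⟧ (≈⇒ e f)     I M =
  (λ g N u → proj₁ (⟦≈⟧ f I (app M N)) (g N (proj₂ (⟦≈⟧ e I N) u))) ,
  (λ g N u → proj₂ (⟦≈⟧ f I (app M N)) (g N (proj₁ (⟦≈⟧ e I N) u)))
⟦≈⟧ ≈comm        I M = (λ { (x , y) → y , x }) , (λ { (x , y) → y , x })
⟦≈⟧ ≈assoc       I M = (λ { ((x , y) , z) → x , (y , z) }) , (λ { (x , (y , z)) → (x , y) , z })
⟦≈⟧ ≈idem        I M = proj₁ , (λ x → x , x)
⟦≈⟧ ≈unit        I M = proj₂ , (λ x → tt , x)

⟦⊑⟧ : ∀ {U V} → U ⊑ V → ∀ I M → ⟦ U ⟧ I M → ⟦ V ⟧ I M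
⟦⊑⟧ (⊑≈ e)       I M = proj₁ (⟦≈⟧ e I M)
⟦⊑⟧ (⊑trans p q) I M x = ⟦⊑⟧ q I M (⟦⊑⟧ p I M x)
⟦⊑⟧ ⊑⊓l          I M = proj₁
⟦⊑⟧ (⊑⊓ p q)     I M (x , y) = ⟦⊑⟧ p I M x , ⟦⊑⟧ q I M y
⟦⊑⟧ (⊑⇒ p q)     I M g N u = ⟦⊑⟧ q I (app M N) (g N (⟦⊑⟧ p I N u))

Saturated : (ℕ → Pred) → Set
Saturated I = ∀ a → βSaturated (I a)

mutual
  ⟦⟧T-saturated : ∀ {I} → Saturated I → ∀ T → βSaturated (⟦ T ⟧T I)
  ⟦⟧T-saturated s (atom a) r m       = s a r m
  ⟦⟧T-saturated s (U ⇒ T)  r f N u   = ⟦⟧T-saturated s T (app* r ε) (f N u)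

  ⟦⟧-saturated : ∀ {I} → Saturated I → ∀ U → βSaturated (⟦ U ⟧ I)
  ⟦⟧-saturated s ω       r m       = tt
  ⟦⟧-saturated s (U ⊓ V) r (a , b) = ⟦⟧-saturated s U r a , ⟦⟧-saturated s V r b
  ⟦⟧-saturated s (↑ T)   r m       = ⟦⟧T-saturated s T r m

Validates : (ℕ → Pred) → Env → (ℕ → Term) → Set
Validates I Γ σ = ∀ x A → Γ x ≡ just A → ⟦ A ⟧ I (σ x)

validates-≼ : ∀ {I Γ Γ' σ} → Γ' ≼ Γ → Validates I Γ' σ → Validates I Γ σ
validates-≼ {I} {σ = σ} p h x A e = let (B , eB , l) = p x A e in ⟦⊑⟧ l I (σ x) (h x B eB)

redex-sound : ∀ {I} → Saturated I → ∀ T σ M N →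
  ⟦ T ⟧T I (subst (N ∷ˢ σ) M) → ⟦ T ⟧T I (app (subst σ (lam M)) N)
redex-sound {I} s T σ M N m =
  ⟦⟧T-saturated s T (β ◅ ε) (transport (⟦ T ⟧T I) (sym (subst-exts-single σ N M)) m)

soundness : ∀ {M Γ U} → M ⦂⟨ Γ ⊢ U ⟩ → ∀ I → Saturated I → ∀ σ → Validates I Γ σ → ⟦ U ⟧ I (subst σ M)
soundness (ax x T) I s σ h = h x (↑ T) (single-env-self x (↑ T))
soundness (ωr M)   I s σ h = tt
soundness (→i {Γ} {M} {U} {T} d e) I s σ h N u = redex-sound s T σ M N (soundness d I s (N ∷ˢ σ) h-body)
  where h-body : Validates I Γ (N ∷ˢ σ)
        h-body zero    A e' = transport (λ Z → ⟦ Z ⟧ I N) (just-inj (trans (sym e) e')) u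
        h-body (suc x) A e' = h x A e'
soundness (→i' {Γ} {M} {T} d e) I s σ h N u = redex-sound s T σ M N (soundness d I s (N ∷ˢ σ) h-body)
  where h-body : Validates I Γ (N ∷ˢ σ)
        h-body zero    A e' with trans (sym e) e'
        ... | ()
        h-body (suc x) A e' = h x A e'
soundness (→e {Γ₁} {Γ₂} {M₂ = M₂} d₁ d₂) I s σ h =
  soundness d₁ I s σ (validates-≼ (meet≼ˡ {Γ₁} {Γ₂}) h) (subst σ M₂)
            (soundness d₂ I s σ (validates-≼ (meet≼ʳ {Γ₁} {Γ₂}) h))
soundness (⊓i d₁ d₂) I s σ h = soundness d₁ I s σ h , soundness d₂ I s σ h
soundness {M} (⊑r d sb p) I s σ h = ⟦⊑⟧ sb I (subst σ M) (soundness d I s σ (validates-≼ (⊑ₑ⇒≼ p) h))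

expansion-of-typable-meaning : ∀ {M U} → (∃ λ N → (M ▷β* N) × (N ⦂⟨ emptyEnv ⊢ U ⟩)) → Meaning U M
expansion-of-typable-meaning {U = U} (N , r , d) I s =
  ⟦⟧-saturated s U r (transport (⟦ U ⟧ I) (subst-var N) (soundness d I s var (λ x A ())))

bound : Term → ℕ
bound (var y)   = suc y
bound (lam M)   = pred (bound M)
bound (app M N) = bound M ⊔ bound N

fresh : ∀ M x → bound M ≤ x → fv x M ≡ false
fresh (var y)   x le = ≡ᵇ-false x y (λ { refl → NP.<-irrefl refl le })
fresh (lam M)   x le = fresh M (suc x) (NP.≤-trans (≤-suc-pred (bound M)) (s≤s le))
  where ≤-suc-pred : ∀ m → m ≤ suc (pred m)
        ≤-suc-pred zero    = z≤n
        ≤-suc-pred (suc m) = NP.≤-refl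
fresh (app M N) x le rewrite fresh M x (NP.m⊔n≤o⇒m≤o (bound M) (bound N) le)
                           | fresh N x (NP.m⊔n≤o⇒n≤o (bound M) (bound N) le) = refl

-- Fix a variable s and interpret every atom as OnlyFree s.  Positive types
-- are then included in OnlyFree s and negative types contain it; for s
-- fresh in M the reduct obtained is closed.

module ClosedReduct (s : ℕ) where

  OnlyFree : Pred
  OnlyFree M = ∃ λ N → (M ▷β* N) × (∀ y → y ∈FV N → y ≡ s)

  I : ℕ → Pred
  I _ = OnlyFree

  I-saturated : Saturated I
  I-saturated a r (N , r' , h) = N , r ◅◅ r' , h

  only-free-unapply : ∀ M → OnlyFree (app M (var s)) → OnlyFree M
  only-free-unapply M (N , r , only) with app-var-reduct r
  ... | inj₁ (M' , r' , refl) = M' , r' , λ y e → only y (fv-appˡ M' (var s) e)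
  ... | inj₂ (abstraction P r' e) = lam P , r' , λ y fy →
          only y (transport (y ∈FV_) e (fv-rename⁺ (bind0 s) P (suc y) fy))

  mutual
    positive-only-free : ∀ {U} → Pos U → ∀ M → ⟦ U ⟧ I M → OnlyFree M
    positive-only-free (p-atom a)  M m       = m
    positive-only-free (p-⊓ V p)   M (m , _) = positive-only-free p M m
    positive-only-free (p-⇒ n p)   M f       = only-free-unapply M
      (positive-only-free p (app M (var s)) (f (var s) (only-free-negative n (var s) s-only-free)))
      where s-only-free : OnlyFree (var s)
            s-only-free = var s , ε , λ y e → ≡ᵇ-sound y s e
    positive-only-free (p-≈ p e)   M m       = positive-only-free p M (proj₂ (⟦≈⟧ e I M) m)

    only-free-negative : ∀ {U} → Neg U → ∀ M → OnlyFree M → ⟦ U ⟧ I M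
    only-free-negative (n-atom a)  M d = d
    only-free-negative n-ω         M d = tt
    only-free-negative (n-⊓ n₁ n₂) M d = only-free-negative n₁ M d , only-free-negative n₂ M d
    only-free-negative (n-⇒ p n) M (N , r , only) Q q =
      let (Q' , r' , only') = positive-only-free p Q q
      in only-free-negative n (app M Q) (app N Q' , app* r r' , λ y e → [ only y , only' y ] (fv-app⁻ N Q' e))
    only-free-negative (n-≈ n e)   M d = proj₁ (⟦≈⟧ e I M) (only-free-negative n M d)

  meaning-only-free : ∀ {U} → Pos U → ∀ M → Meaning U M → OnlyFree M
  meaning-only-free p M m = positive-only-free p M (m I I-saturated)

positive-closed-reduct : ∀ {U} → Pos U → ∀ M → Meaning U M → ∃ λ N → (M ▷β* N) × Closed N
positive-closed-reduct p M m with ClosedReduct.meaning-only-free (bound M) p M m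
... | N , r , only = N , r , closed-by-fv {N} not-free
  where not-free : ∀ y → y ∈FV N → ⊥
        not-free y e with only y e
        ... | refl = ∈FV-contra {y} {M} (fv-▷* y r e) (fresh M (bound M) NP.≤-refl)

mutual
  parts : UTy → List UTy
  parts U = U ∷ proper-parts U

  proper-parts : UTy → List UTy
  proper-parts ω           = []
  proper-parts (U ⊓ V)     = parts U ++ parts V
  proper-parts (↑ atom a)  = []
  proper-parts (↑ (U ⇒ T)) = parts U ++ parts (↑ T)

-- the n-th entry of a list of types (ω when out of range)
nth : List UTy → ℕ → UTy
nth []       n       = ω
nth (A ∷ xs) zero    = A
nth (A ∷ xs) (suc n) = nth xs n

nth-index : ∀ {W} xs → W ∈ xs → ∃ λ i → i < length xs × nth xs i ≡ W
nth-index (A ∷ xs) (here refl) = zero , s≤s z≤n , refl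
nth-index (A ∷ xs) (there m)   = let (i , lt , e) = nth-index xs m in suc i , s≤s lt , e

⊢-var-⊑ : ∀ {Γ x W V} → Γ x ≡ just W → Γ ⊢ var x ∶ V → W ⊑ V
⊢-var-⊑ {V = V} eW t = ⊑-by-components _ V λ T m →
  let (A , eA , l) = ⊢-gen-var (⊢-component t m) in transport (_⊑ ↑ T) (just-inj (trans (sym eA) eW)) l

module Completeness (U₀ : UTy) where

  -- B declares every part of U₀, each at infinitely many variables
  B : Env
  B x = just (nth (parts U₀) (x % length (parts U₀)))

  fresh-declared : ∀ W → W ∈ parts U₀ → ∀ M → ∃ λ x → B x ≡ just W × fv x M ≡ false
  fresh-declared W m M with nth-index (parts U₀) m
  ... | i , lt , e = x , cong just (trans (cong (nth (parts U₀)) x%len≡i) e) , fresh M x bound≤x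
    where len = length (parts U₀)
          x = i + bound M * len
          x%len≡i : x % len ≡ i
          x%len≡i = trans (DM.[m+kn]%n≡m%n i (bound M) len) (DM.m<n⇒m%n≡m lt)
          bound≤x : bound M ≤ x
          bound≤x = NP.≤-trans (NP.m≤m*n (bound M) len) (NP.m≤n+m (bound M * len) i)

  PartOf₀ : UTy → Set
  PartOf₀ U = ∀ V → V ∈ parts U → V ∈ parts U₀

  part-⊓ˡ : ∀ {U V} → PartOf₀ (U ⊓ V) → PartOf₀ U
  part-⊓ˡ h W m = h W (there (∈-++⁺ˡ m))

  part-⊓ʳ : ∀ {U V} → PartOf₀ (U ⊓ V) → PartOf₀ V
  part-⊓ʳ {U} h W m = h W (there (∈-++⁺ʳ (parts U) m))

  part-dom : ∀ {W S} → PartOf₀ (↑ (W ⇒ S)) → PartOf₀ W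
  part-dom h V m = h V (there (∈-++⁺ˡ m))

  part-cod : ∀ {W S} → PartOf₀ (↑ (W ⇒ S)) → PartOf₀ (↑ S)
  part-cod {W} h V m = h V (there (∈-++⁺ʳ (parts W) m))

  J : ℕ → Pred
  J a M = ∃ λ N → (M ▷β* N) × (B ⊢ N ∶ ↑ atom a)

  J-saturated : Saturated J
  J-saturated a r (N , r' , t) = N , r ◅◅ r' , t

  typed-unapply : ∀ {W S M x N} → B x ≡ just W → fv x M ≡ false → app M (var x) ▷β* N → B ⊢ N ∶ ↑ S →
    ∃ λ N → (M ▷β* N) × (B ⊢ N ∶ ↑ (W ⇒ S))
  typed-unapply {W} {S} {M} {x} eW x∉M r t with app-var-reduct r
  ... | inj₁ (M' , r' , refl) =
    let (V , S' , t₁ , t₂ , l) = ⊢-gen-app t in M' , r' , ⊢-sub t₁ (⊑⇒ (⊢-var-⊑ eW t₂) (≤T⇒⊑ S' S l))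
  ... | inj₂ (abstraction P r' refl) = lam P , r' , ⊢-lam (transport (λ K → (W ∷ₑ B) ⊢ K ∶ ↑ S) unbound typed)
    where
      declares : RenamesInto B (W ∷ₑ B) (unbind0 x)
      declares y A e with y ≡ᵇ x in eq
      ... | true rewrite ≡ᵇ-sound y x eq = W , refl , transport (W ⊑_) (just-inj (trans (sym eW) e)) ⊑refl
      ... | false = A , e , ⊑refl
      typed : (W ∷ₑ B) ⊢ rename (unbind0 x) (rename (bind0 x) P) ∶ ↑ S
      typed = ⊢-rename (unbind0 x) declares _ (↑ S) t
      x∉P : fv x (lam P) ≡ false
      x∉P with fv x (lam P) in eq
      ... | false = refl
      ... | true  = ⊥-elim (∈FV-contra {x} {M} (fv-▷* x r' eq) x∉M)
      unbound : rename (unbind0 x) (rename (bind0 x) P) ≡ P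
      unbound = unbind-bind x P x∉P

  mutual
    ⟦⟧⇒typable : ∀ U → PartOf₀ U → ∀ M → ⟦ U ⟧ J M → ∃ λ N → (M ▷β* N) × (B ⊢ N ∶ U)
    ⟦⟧⇒typable ω       h M _       = M , ε , ⊢-ω (λ x _ → _ , refl)
    ⟦⟧⇒typable (U ⊓ V) h M (a , b) =
      let (N₁ , r₁ , t₁) = ⟦⟧⇒typable U (part-⊓ˡ h) M a
          (N₂ , r₂ , t₂) = ⟦⟧⇒typable V (part-⊓ʳ {U} h) M b
          (R , q₁ , q₂)  = confluence r₁ r₂
      in R , r₁ ◅◅ q₁ , ⊢-⊓ (subject-reduction* U t₁ q₁) (subject-reduction* V t₂ q₂)
    ⟦⟧⇒typable (↑ T)   h M m       = ⟦⟧T⇒typable T h M m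

    ⟦⟧T⇒typable : ∀ T → PartOf₀ (↑ T) → ∀ M → ⟦ T ⟧T J M → ∃ λ N → (M ▷β* N) × (B ⊢ N ∶ ↑ T)
    ⟦⟧T⇒typable (atom a) h M m = m
    ⟦⟧T⇒typable (W ⇒ S)  h M f =
      let (x , eW , x∉M) = fresh-declared W (part-dom {W} {S} h W (here refl)) M
          x∈⟦W⟧ = typable⇒⟦⟧ W (part-dom {W} {S} h) (var x) (var x) ε (⊢-var eW)
          (N , r , t) = ⟦⟧T⇒typable S (part-cod {W} h) (app M (var x)) (f (var x) x∈⟦W⟧)
      in typed-unapply eW x∉M r t

    typable⇒⟦⟧ : ∀ U → PartOf₀ U → ∀ M N → M ▷β* N → B ⊢ N ∶ U → ⟦ U ⟧ J M
    typable⇒⟦⟧ ω       h M N r t = tt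
    typable⇒⟦⟧ (U ⊓ V) h M N r t = typable⇒⟦⟧ U (part-⊓ˡ h) M N r (⊢-sub t ⊑⊓l) ,
                                   typable⇒⟦⟧ V (part-⊓ʳ {U} h) M N r (⊢-sub t ⊑⊓r)
    typable⇒⟦⟧ (↑ T)   h M N r t = typable⇒⟦⟧T T h M N r t

    typable⇒⟦⟧T : ∀ T → PartOf₀ (↑ T) → ∀ M N → M ▷β* N → B ⊢ N ∶ ↑ T → ⟦ T ⟧T J M
    typable⇒⟦⟧T (atom a) h M N r t = N , r , t
    typable⇒⟦⟧T (W ⇒ S)  h M N r t Q q =
      let (Q' , r' , t') = ⟦⟧⇒typable W (part-dom {W} {S} h) Q q
      in typable⇒⟦⟧T S (part-cod {W} h) (app M Q) (app N Q') (app* r r') (⊢-app t t')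

  meaning⇒typable : ∀ M → Meaning U₀ M → ∃ λ N → (M ▷β* N) × (B ⊢ N ∶ U₀)
  meaning⇒typable M m = ⟦⟧⇒typable U₀ (λ V → id) M (m J J-saturated)

-- for positive U, a common reduct of the closed reduct (part 1) and of the
-- typable reduct (completeness) is closed and typable at U, hence from ()
positive-typable-reduct : ∀ {U} → Pos U → ∀ M → Meaning U M →
  ∃ λ N → (M ▷β* N) × (N ⦂⟨ emptyEnv ⊢ U ⟩)
positive-typable-reduct {U} p M m =
  let (C , M▷C , C-closed) = positive-closed-reduct p M m
      (N , M▷N , N-typable) = Completeness.meaning⇒typable U M m
      (R , C▷R , N▷R) = confluence M▷C M▷N
  in R , M▷N ◅◅ N▷R , closed-typing (subject-reduction* U N-typable N▷R) (closed-▷* C▷R C-closed)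

corollary5p8 : ∀ (U : UTy) → Pos U →
    (∀ M → Meaning U M → ∃ λ N → (M ▷β* N) × Closed N)
    × (∀ M → Meaning U M ⇔ (∃ λ N → (M ▷β* N) × (N ⦂⟨ emptyEnv ⊢ U ⟩)))
corollary5p8 U p =
  positive-closed-reduct p ,
  λ M → mk⇔ (positive-typable-reduct p M) expansion-of-typable-meaning
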